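{- For all integers $k\geq2$ and $d\geq0$, the following holds in $\mathcal{E}_{k+d}$: \[ \sum_{\substack{k_1+k_2=k,\ d_1+d_2=d\\ k_1,k_2\geq1,\ d_1,d_2\geq0\\ (k_1,d_2)\neq(1,0)}}(-1)^{d_2}\binom{d}{d_2}G\begin{bmatrix}k_1,k_2\\d_1,d_2\end{bmatrix}=G\begin{bmatrix}k\\d\end{bmatrix}-\frac1{d+1}G\begin{bmatrix}k-1\\d+1\end{bmatrix}. \]
   Context: Formal double Eisenstein space $\mathcal{E}_K$ ($K\geq1$): the $\mathbb{Q}$-vector space spanned by formal symbols $G\begin{bmatrix}k\\ d\end{bmatrix}$ ($k\geq1,d\geq0,k+d=K$), $G\begin{bmatrix}k_1,k_2\\ d_1,d_2\end{bmatrix}$, $P\begin{bmatrix}k_1,k_2\\ d_1,d_2\end{bmatrix}$ ($k_i\geq1,d_i\geq0$, $k_1+k_2+d_1+d_2=K$) modulo the relations, for all such indices: $P\begin{bmatrix}k_1,k_2\\ d_1,d_2\end{bmatrix}=G\begin{bmatrix}k_1,k_2\\ d_1,d_2\end{bmatrix}+G\begin{bmatrix}k_2,k_1\\ d_2,d_1\end{bmatrix}+G\begin{bmatrix}k_1+k_2\\ d_1+d_2\end{bmatrix}=\sum_{\substack{l_1+l_2=k_1+k_2,\ e_1+e_2=d_1+d_2\\ l_i\geq1,\ e_i\geq0}}\left(\binom{l_1-1}{k_1-1}\binom{d_1}{e_1}(-1)^{d_1-e_1}+\binom{l_1-1}{k_2-1}\binom{d_2}{e_1}(-1)^{d_2-e_1}\right)G\begin{bmatrix}l_1,l_2\\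 e_1,e_2\end{bmatrix}+\frac{d_1!d_2!}{(d_1+d_2+1)!}\binom{k_1+k_2-2}{k_1-1}G\begin{bmatrix}k_1+k_2-1\\ d_1+d_2+1\end{bmatrix}$. -}

module Defs where

open import Data.Nat as ℕ using (ℕ; zero; suc; _≤_; _∸_; _!)
open import Data.Nat.Properties using (_!≢0)
open import Data.Nat.Combinatorics using (_C_)
open import Data.Integer as ℤ using (ℤ; +_)
open import Data.Rational as ℚ using (ℚ; 0ℚ; 1ℚ; _+_; _*_; -_)
open import Data.List using (List; []; _∷_; _++_; map; concatMap; upTo)
open import Data.Product using (_×_; _,_; ∃)
open import Data.Bool using (Bool; true; false; if_then_else_)
open import Relation.Nullary using (Dec; yes; no; does)
open import Relation.Binary.PropositionalEquality using (_≡_; refl)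

-- Formal generators.
--   G1 k d          stands for  G[k ; d]
--   G2 k₁ k₂ d₁ d₂  stands for  G[k₁,k₂ ; d₁,d₂]
--   P2 k₁ k₂ d₁ d₂  stands for  P[k₁,k₂ ; d₁,d₂]

data Gen : Set where
  G1 : ℕ → ℕ → Gen
  G2 : ℕ → ℕ → ℕ → ℕ → Gen
  P2 : ℕ → ℕ → ℕ → ℕ → Gen

_==_ : Gen → Gen → Bool
G1 a b == G1 a' b' = does (a ℕ.≟ a') Data.Bool.∧ does (b ℕ.≟ b')
G2 a b c e == G2 a' b' c' e' =
  does (a ℕ.≟ a') Data.Bool.∧ does (b ℕ.≟ b') Data.Bool.∧ does (c ℕ.≟ c') Data.Bool.∧ does (e ℕ.≟ e')
P2 a b c e == P2 a' b' c' e' =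
  does (a ℕ.≟ a') Data.Bool.∧ does (b ℕ.≟ b') Data.Bool.∧ does (c ℕ.≟ c') Data.Bool.∧ does (e ℕ.≟ e')
_ == _ = false

Comb : Set
Comb = List (ℚ × Gen)

coeff : Comb → Gen → ℚ
coeff [] g = 0ℚ
coeff ((c , h) ∷ xs) g = if h == g then c + coeff xs g else coeff xs g

scale : ℚ → Comb → Comb
scale c = map (λ { (a , g) → (c * a , g) })

neg : Comb → Comb
neg = scale (- 1ℚ)

ℕ→ℚ : ℕ → ℚ
ℕ→ℚ n = + n ℚ./ 1

sgn : ℕ → ℚ
sgn zero = 1ℚ
sgn (suc n) = - sgn n

-- range [a, a+1, ..., b]  (empty if b < a)
range : ℕ → ℕ → List ℕ
range a b = map (ℕ._+ a) (upTo (suc b ∸ a))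

stuffleRel : ℕ → ℕ → ℕ → ℕ → Comb
stuffleRel k₁ k₂ d₁ d₂ =
  (1ℚ , P2 k₁ k₂ d₁ d₂) ∷ (- 1ℚ , G2 k₁ k₂ d₁ d₂) ∷ (- 1ℚ , G2 k₂ k₁ d₂ d₁)
    ∷ (- 1ℚ , G1 (k₁ ℕ.+ k₂) (d₁ ℕ.+ d₂)) ∷ []

shuffleSum : ℕ → ℕ → ℕ → ℕ → Comb
shuffleSum k₁ k₂ d₁ d₂ =
  concatMap (λ l₁ → map (λ e₁ →
      ( ℕ→ℚ (((l₁ ∸ 1) C (k₁ ∸ 1)) ℕ.* (d₁ C e₁)) * sgn (d₁ ∸ e₁)
        + ℕ→ℚ (((l₁ ∸ 1) C (k₂ ∸ 1)) ℕ.* (d₂ C e₁)) * sgn (d₂ ∸ e₁)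
      , G2 l₁ (k₁ ℕ.+ k₂ ∸ l₁) e₁ (d₁ ℕ.+ d₂ ∸ e₁)))
    (range 0 (d₁ ℕ.+ d₂)))
  (range 1 (k₁ ℕ.+ k₂ ∸ 1))

factRatio : ℕ → ℕ → ℚ
factRatio d₁ d₂ = (+ (d₁ ! ℕ.* d₂ !)) ℚ./ (suc (d₁ ℕ.+ d₂)) !
  where instance _ = (suc (d₁ ℕ.+ d₂)) !≢0

shuffleRel : ℕ → ℕ → ℕ → ℕ → Comb
shuffleRel k₁ k₂ d₁ d₂ =
  (1ℚ , P2 k₁ k₂ d₁ d₂) ∷ neg (shuffleSum k₁ k₂ d₁ d₂
    ++ ((factRatio d₁ d₂ * ℕ→ℚ ((k₁ ℕ.+ k₂ ∸ 2) C (k₁ ∸ 1)))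
         , G1 (k₁ ℕ.+ k₂ ∸ 1) (suc (d₁ ℕ.+ d₂))) ∷ [])

record RelIx (K : ℕ) : Set where
  constructor relIx
  field
    k₁ k₂ d₁ d₂ : ℕ
    k₁≥1 : 1 ≤ k₁
    k₂≥1 : 1 ≤ k₂
    weight : k₁ ℕ.+ k₂ ℕ.+ d₁ ℕ.+ d₂ ≡ K
    isShuffle : Bool

relOf : ∀ {K} → RelIx K → Comb
relOf (relIx k₁ k₂ d₁ d₂ _ _ _ false) = stuffleRel k₁ k₂ d₁ d₂
relOf (relIx k₁ k₂ d₁ d₂ _ _ _ true) = shuffleRel k₁ k₂ d₁ d₂

relComb : ∀ {K} → List (ℚ × RelIx K) → Comb
relComb [] = []
relComb ((c , r) ∷ rs) = scale c (relOf r) ++ relComb rs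

-- Equality in 𝓔_K (= free space modulo the span of the weight-K relations):
-- x - y is, coefficientwise, a finite ℚ-linear combination of relations.
EqInE : (K : ℕ) → Comb → Comb → Set
EqInE K x y = ∃ λ (rs : List (ℚ × RelIx K)) →
  ∀ g → coeff (x ++ neg y) g ≡ coeff (relComb rs) g

excluded : ℕ → ℕ → Bool
excluded k₁ d₂ = does (k₁ ℕ.≟ 1) Data.Bool.∧ does (d₂ ℕ.≟ 0)

prop41LHS : ℕ → ℕ → Comb
prop41LHS k d =
  concatMap (λ k₁ → concatMap (λ d₂ →
      if excluded k₁ d₂ then []
      else (sgn d₂ * ℕ→ℚ (d C d₂) , G2 k₁ (k ∸ k₁) (d ∸ d₂) d₂) ∷ [])
    (range 0 d))
  (range 1 (k ∸ 1))

prop41RHS : ℕ → ℕ → Comb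
prop41RHS k d =
  (1ℚ , G1 k d) ∷ (- ((+ 1) ℚ./ suc d) , G1 (k ∸ 1) (suc d)) ∷ []

-- Subtract the shuffle relation for P[1,k-1;d,0] from the stuffle relation for the
-- same symbol.  In the shuffle expansion the factor C(l₁-1,0) C(d,e₁) (-1)^(d-e₁)
-- yields, after the substitution d₂ = d - e₁, every term of the left-hand side together
-- with the excluded term G[1,k-1;d,0]; the factor C(l₁-1,k-2) C(0,e₁) survives only at
-- (l₁,e₁) = (k-1,0), giving G[k-1,1;0,d]; and the last term is G[k-1;d+1]/(d+1).  The
-- stuffle relation writes P[1,k-1;d,0] as G[1,k-1;d,0] + G[k-1,1;0,d] + G[k;d], so the
-- difference of the two relations is the claimed identity.
module Submission where

open import Defs
open import Data.Nat using (ℕ; _≤_; _+_)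

open import Data.Nat as ℕ using (zero; suc; _∸_; _!; z≤n; s≤s; NonZero)
import Data.Nat.Properties as ℕₚ
open import Data.Nat.Combinatorics using (_C_; nCk≡nC[n∸k]; k>n⇒nCk≡0; nCn≡1)
open import Data.Fin using (Fin; toℕ; fromℕ<; punchIn)
open import Data.Fin.Properties using (toℕ-fromℕ<; toℕ-injective; toℕ≤pred[n]; punchInᵢ≢i; opposite-prop)
open import Data.Fin.Permutation using (reverse)
open import Data.Integer using (+_)
import Data.Integer.Properties as ℤₚ
open import Data.Rational as ℚ using (ℚ; 0ℚ; 1ℚ; -_)
import Data.Rational.Properties as ℚₚ
import Data.Rational.Unnormalised as ℚᵘ
open import Data.Rational.Solver using (module +-*-Solver)
open import Algebra.Bundles using (CommutativeMonoid)
open import Algebra.Properties.CommutativeSemigroup (CommutativeMonoid.commutativeSemigroup ℚₚ.+-0-commutativeMonoid)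
  using (xy∙z≈xz∙y)
open import Algebra.Properties.CommutativeMonoid.Sum ℚₚ.+-0-commutativeMonoid
  using (sum-syntax; sum⁺-syntax; ∑-distrib-+; sum-cong-≗; sum-replicate-zero; sum-remove; ∑-permute)
open import Data.List using ([]; _∷_; _++_; map; foldr; concatMap; applyUpTo; upTo)
open import Data.List.Properties using (concatMap-map; concatMap-pure)
open import Data.Product using (_×_; _,_)
open import Data.Bool using (true; false; if_then_else_)
open import Function using (id; _∘_)
open import Relation.Nullary using (contradiction)
open import Relation.Binary.PropositionalEquality

δ : Gen → Gen → ℚ
δ h g = if h == g then 1ℚ else 0ℚ

coeff-∷ : ∀ c h xs g → coeff ((c , h) ∷ xs) g ≡ c ℚ.* δ h g ℚ.+ coeff xs g
coeff-∷ c h xs g with h == g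
... | true  = cong (ℚ._+ coeff xs g) (sym (ℚₚ.*-identityʳ c))
... | false = sym (trans (cong (ℚ._+ coeff xs g) (ℚₚ.*-zeroʳ c)) (ℚₚ.+-identityˡ _))

coeff-singleton : ∀ c h g → coeff ((c , h) ∷ []) g ≡ c ℚ.* δ h g
coeff-singleton c h g = trans (coeff-∷ c h [] g) (ℚₚ.+-identityʳ _)

coeff-expand : ∀ xs g → coeff xs g ≡ foldr (λ { (c , h) s → c ℚ.* δ h g ℚ.+ s }) 0ℚ xs
coeff-expand []             g = refl
coeff-expand ((c , h) ∷ xs) g = trans (coeff-∷ c h xs g) (cong (c ℚ.* δ h g ℚ.+_) (coeff-expand xs g))

coeff-++ : ∀ xs ys g → coeff (xs ++ ys) g ≡ coeff xs g ℚ.+ coeff ys g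
coeff-++ [] ys g = sym (ℚₚ.+-identityˡ _)
coeff-++ ((c , h) ∷ xs) ys g with h == g
... | true  = trans (cong (c ℚ.+_) (coeff-++ xs ys g)) (sym (ℚₚ.+-assoc c _ _))
... | false = coeff-++ xs ys g

coeff-scale : ∀ a xs g → coeff (scale a xs) g ≡ a ℚ.* coeff xs g
coeff-scale a [] g = sym (ℚₚ.*-zeroʳ a)
coeff-scale a ((c , h) ∷ xs) g with h == g
... | true  = trans (cong (a ℚ.* c ℚ.+_) (coeff-scale a xs g)) (sym (ℚₚ.*-distribˡ-+ a c _))
... | false = coeff-scale a xs g

coeff-++-neg : ∀ xs ys g → coeff (xs ++ neg ys) g ≡ coeff xs g ℚ.+ (- 1ℚ) ℚ.* coeff ys g
coeff-++-neg xs ys g = trans (coeff-++ xs (neg ys) g) (cong (coeff xs g ℚ.+_) (coeff-scale (- 1ℚ) ys g))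

coeff-relComb-∷ : ∀ {K} c (r : RelIx K) rs g →
  coeff (relComb ((c , r) ∷ rs)) g ≡ c ℚ.* coeff (relOf r) g ℚ.+ coeff (relComb rs) g
coeff-relComb-∷ c r rs g =
  trans (coeff-++ (scale c (relOf r)) (relComb rs) g) (cong (ℚ._+ _) (coeff-scale c (relOf r) g))

coeff-concatMap-applyUpTo : ∀ (F : ℕ → Comb) u n g →
  coeff (concatMap F (applyUpTo u n)) g ≡ ∑[ i < n ] coeff (F (u (toℕ i))) g
coeff-concatMap-applyUpTo F u zero    g = refl
coeff-concatMap-applyUpTo F u (suc n) g = trans (coeff-++ (F (u 0)) _ g)
  (cong (coeff (F (u 0)) g ℚ.+_) (coeff-concatMap-applyUpTo F (u ∘ suc) n g))

coeff-concatMap-range : ∀ (F : ℕ → Comb) a b g →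
  coeff (concatMap F (range a b)) g ≡ ∑[ i < suc b ∸ a ] coeff (F (a + toℕ i)) g
coeff-concatMap-range F a b g = begin
  coeff (concatMap F (map (_+ a) (upTo n))) g
    ≡⟨ cong (λ xs → coeff xs g) (concatMap-map F (_+ a) (upTo n)) ⟩
  coeff (concatMap (F ∘ (_+ a)) (upTo n)) g
    ≡⟨ coeff-concatMap-applyUpTo (F ∘ (_+ a)) id n g ⟩
  ∑[ i < n ] coeff (F (toℕ i + a)) g
    ≡⟨ sum-cong-≗ {n} (λ i → cong (λ x → coeff (F x) g) (ℕₚ.+-comm (toℕ i) a)) ⟩
  ∑[ i < n ] coeff (F (a + toℕ i)) g ∎
  where
  open ≡-Reasoning
  n : ℕ
  n = suc b ∸ a

coeff-map-range : ∀ (F : ℕ → ℚ × Gen) a b g →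
  coeff (map F (range a b)) g ≡ ∑[ i < suc b ∸ a ] coeff (F (a + toℕ i) ∷ []) g
coeff-map-range F a b g = begin
  coeff (map F (range a b)) g
    ≡⟨ cong (λ xs → coeff xs g) (sym (concatMap-pure (map F (range a b)))) ⟩
  coeff (concatMap (_∷ []) (map F (range a b))) g
    ≡⟨ cong (λ xs → coeff xs g) (concatMap-map (_∷ []) F (range a b)) ⟩
  coeff (concatMap (λ x → F x ∷ []) (range a b)) g
    ≡⟨ coeff-concatMap-range (λ x → F x ∷ []) a b g ⟩
  ∑[ i < suc b ∸ a ] coeff (F (a + toℕ i) ∷ []) g ∎
  where open ≡-Reasoning

∑-reverse : ∀ n (f : ℕ → ℚ) → ∑[ i ≤ n ] f (toℕ i) ≡ ∑[ i ≤ n ] f (n ∸ toℕ i)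
∑-reverse n f = trans (∑-permute (f ∘ toℕ) reverse) (sum-cong-≗ {suc n} (cong f ∘ opposite-prop))

∑-vanishing-off : ∀ {n j} (f : ℕ → ℚ) → j ≤ n → (∀ {i} → i ≤ n → i ≢ j → f i ≡ 0ℚ) →
  ∑[ i ≤ n ] f (toℕ i) ≡ f j
∑-vanishing-off {n} {j} f j≤n vanish = begin
  ∑[ i ≤ n ] f (toℕ i)
    ≡⟨ sum-remove {i = jᶠ} (f ∘ toℕ) ⟩
  f (toℕ jᶠ) ℚ.+ ∑[ i < n ] f (toℕ (punchIn jᶠ i))
    ≡⟨ cong₂ ℚ._+_ (cong f (toℕ-fromℕ< (s≤s j≤n))) (trans (sum-cong-≗ {n} off) (sum-replicate-zero n)) ⟩
  f j ℚ.+ 0ℚ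
    ≡⟨ ℚₚ.+-identityʳ (f j) ⟩
  f j ∎
  where
  open ≡-Reasoning
  jᶠ : Fin (suc n)
  jᶠ = fromℕ< (s≤s j≤n)
  off : ∀ i → f (toℕ (punchIn jᶠ i)) ≡ 0ℚ
  off i = vanish (toℕ≤pred[n] (punchIn jᶠ i))
    (λ eq → punchInᵢ≢i jᶠ i (toℕ-injective (trans eq (sym (toℕ-fromℕ< (s≤s j≤n))))))

lhsTerm : ℕ → ℕ → Gen → ℕ → ℕ → ℚ
lhsTerm k d g k₁ d₂ = sgn d₂ ℚ.* ℕ→ℚ (d C d₂) ℚ.* δ (G2 k₁ (k ∸ k₁) (d ∸ d₂) d₂) g

unrestrictedLHS : ℕ → ℕ → Gen → ℚ
unrestrictedLHS k d g = ∑[ i < k ∸ 1 ] ∑[ j ≤ d ] lhsTerm k d g (suc (toℕ i)) (toℕ j)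

coeff-prop41LHS : ∀ m d g →
  coeff (prop41LHS (2 + m) d) g ℚ.+ δ (G2 1 (suc m) d 0) g ≡ unrestrictedLHS (2 + m) d g
coeff-prop41LHS m d g = begin
  coeff (prop41LHS k d) g ℚ.+ δ₀
    ≡⟨ cong (ℚ._+ δ₀) columns ⟩
  (R 0 ℚ.+ Rs) ℚ.+ δ₀
    ≡⟨ xy∙z≈xz∙y (R 0) Rs δ₀ ⟩
  (R 0 ℚ.+ δ₀) ℚ.+ Rs
    ≡⟨ cong₂ ℚ._+_ firstColumn
         (sum-cong-≗ {m} (λ i → sum-cong-≗ {suc d} (λ j → included (2 + toℕ i) (toℕ j) refl))) ⟩
  unrestrictedLHS k d g ∎
  where
  open ≡-Reasoning
  k : ℕ
  k = 2 + m
  δ₀ : ℚ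
  δ₀ = δ (G2 1 (suc m) d 0) g
  restricted : ℕ → ℕ → Comb
  restricted k₁ d₂ = if excluded k₁ d₂ then []
    else (sgn d₂ ℚ.* ℕ→ℚ (d C d₂) , G2 k₁ (k ∸ k₁) (d ∸ d₂) d₂) ∷ []
  included : ∀ k₁ d₂ → excluded k₁ d₂ ≡ false → coeff (restricted k₁ d₂) g ≡ lhsTerm k d g k₁ d₂
  included k₁ d₂ eq rewrite eq =
    coeff-singleton (sgn d₂ ℚ.* ℕ→ℚ (d C d₂)) (G2 k₁ (k ∸ k₁) (d ∸ d₂) d₂) g
  R : ℕ → ℚ
  R k₁ = ∑[ j ≤ d ] coeff (restricted (suc k₁) (toℕ j)) g
  Rs : ℚ
  Rs = ∑[ i < m ] R (suc (toℕ i))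
  columns : coeff (prop41LHS k d) g ≡ ∑[ i ≤ m ] R (toℕ i)
  columns = trans (coeff-concatMap-range (λ k₁ → concatMap (restricted k₁) (range 0 d)) 1 (suc m) g)
    (sum-cong-≗ {suc m} (λ i → coeff-concatMap-range (restricted (suc (toℕ i))) 0 d g))
  X : ℚ
  X = ∑[ j < d ] lhsTerm k d g 1 (suc (toℕ j))
  firstColumn : R 0 ℚ.+ δ₀ ≡ ∑[ j ≤ d ] lhsTerm k d g 1 (toℕ j)
  firstColumn = begin
    (0ℚ ℚ.+ ∑[ j < d ] coeff (restricted 1 (suc (toℕ j))) g) ℚ.+ δ₀
      ≡⟨ cong (λ x → (0ℚ ℚ.+ x) ℚ.+ δ₀) (sum-cong-≗ {d} (λ j → included 1 (suc (toℕ j)) refl)) ⟩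
    (0ℚ ℚ.+ X) ℚ.+ δ₀
      ≡⟨ cong (ℚ._+ δ₀) (ℚₚ.+-identityˡ X) ⟩
    X ℚ.+ δ₀
      ≡⟨ ℚₚ.+-comm X δ₀ ⟩
    δ₀ ℚ.+ X
      ≡⟨ cong (ℚ._+ X) (sym (ℚₚ.*-identityˡ δ₀)) ⟩
    1ℚ ℚ.* δ₀ ℚ.+ X ∎

coeff-shuffleSum-1-0 : ∀ m d g →
  coeff (shuffleSum 1 (suc m) d 0) g ≡ unrestrictedLHS (2 + m) d g ℚ.+ δ (G2 (suc m) 1 0 d) g
coeff-shuffleSum-1-0 m d g = begin
  coeff (shuffleSum 1 (suc m) d 0) g
    ≡⟨ asColumns ⟩
  ∑[ i ≤ m ] column (d + 0) (toℕ i)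
    ≡⟨ cong (λ D → ∑[ i ≤ m ] column D (toℕ i)) (ℕₚ.+-identityʳ d) ⟩
  ∑[ i ≤ m ] column d (toℕ i)
    ≡⟨ trans (sum-cong-≗ {suc m} (columnSplit ∘ toℕ))
         (∑-distrib-+ {suc m} (λ i → ∑[ j ≤ d ] A (toℕ i) (toℕ j))
                              (λ i → ∑[ j ≤ d ] B (toℕ i) (toℕ j))) ⟩
  ∑[ i ≤ m ] ∑[ j ≤ d ] A (toℕ i) (toℕ j) ℚ.+ ∑[ i ≤ m ] ∑[ j ≤ d ] B (toℕ i) (toℕ j)
    ≡⟨ cong₂ ℚ._+_ (sum-cong-≗ {suc m} (λ i → firstPart (toℕ i))) secondPart ⟩
  unrestrictedLHS k d g ℚ.+ δ (G2 (suc m) 1 0 d) g ∎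
  where
  open ≡-Reasoning
  k : ℕ
  k = 2 + m
  -- the two binomial coefficients of the shuffle relation, at l₁ = suc i and e₁ = e
  coefA coefB : ℕ → ℕ → ℚ
  coefA i e = ℕ→ℚ ((i C 0) ℕ.* (d C e)) ℚ.* sgn (d ∸ e)
  coefB i e = ℕ→ℚ ((i C m) ℕ.* (0 C e)) ℚ.* sgn (0 ∸ e)
  gen : ℕ → ℕ → ℕ → Gen
  gen D i e = G2 (suc i) (k ∸ suc i) e (D ∸ e)
  entry : ℕ → ℕ → ℕ → ℚ × Gen
  entry D l e = (coefA (l ∸ 1) e ℚ.+ coefB (l ∸ 1) e , G2 l (k ∸ l) e (D ∸ e))
  column : ℕ → ℕ → ℚ
  column D i = ∑[ j ≤ D ] ((coefA i (toℕ j) ℚ.+ coefB i (toℕ j)) ℚ.* δ (gen D i (toℕ j)) g)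
  asColumns : coeff (shuffleSum 1 (suc m) d 0) g ≡ ∑[ i ≤ m ] column (d + 0) (toℕ i)
  asColumns = trans (coeff-concatMap-range (λ l → map (entry (d + 0) l) (range 0 (d + 0))) 1 (suc m) g)
    (sum-cong-≗ {suc m} (λ i → trans (coeff-map-range (entry (d + 0) (suc (toℕ i))) 0 (d + 0) g)
      (sum-cong-≗ {suc (d + 0)} (λ j → coeff-singleton (coefA (toℕ i) (toℕ j) ℚ.+ coefB (toℕ i) (toℕ j))
        (gen (d + 0) (toℕ i) (toℕ j)) g))))
  A B : ℕ → ℕ → ℚ
  A i e = coefA i e ℚ.* δ (gen d i e) g
  B i e = coefB i e ℚ.* δ (gen d i e) g
  columnSplit : ∀ i → column d i ≡ ∑[ j ≤ d ] A i (toℕ j) ℚ.+ ∑[ j ≤ d ] B i (toℕ j)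
  columnSplit i = trans
    (sum-cong-≗ {suc d} (λ j → ℚₚ.*-distribʳ-+ (δ (gen d i (toℕ j)) g) (coefA i (toℕ j)) (coefB i (toℕ j))))
    (∑-distrib-+ {suc d} (λ j → A i (toℕ j)) (λ j → B i (toℕ j)))
  reflectA : ∀ i {j} → j ≤ d → A i (d ∸ j) ≡ lhsTerm k d g (suc i) j
  reflectA i {j} j≤d = begin
    A i (d ∸ j)
      ≡⟨ cong₂ (λ c e → ℕ→ℚ c ℚ.* sgn e ℚ.* δ (G2 (suc i) (k ∸ suc i) (d ∸ j) e) g)
           (trans (ℕₚ.*-identityˡ (d C (d ∸ j))) (sym (nCk≡nC[n∸k] j≤d))) (ℕₚ.m∸[m∸n]≡n j≤d) ⟩
    ℕ→ℚ (d C j) ℚ.* sgn j ℚ.* δ (G2 (suc i) (k ∸ suc i) (d ∸ j) j) g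
      ≡⟨ cong (ℚ._* δ (G2 (suc i) (k ∸ suc i) (d ∸ j) j) g) (ℚₚ.*-comm (ℕ→ℚ (d C j)) (sgn j)) ⟩
    lhsTerm k d g (suc i) j ∎
  firstPart : ∀ i → ∑[ j ≤ d ] A i (toℕ j) ≡ ∑[ j ≤ d ] lhsTerm k d g (suc i) (toℕ j)
  firstPart i = trans (∑-reverse d (A i)) (sum-cong-≗ {suc d} (λ j → reflectA i (toℕ≤pred[n] j)))
  secondPart : ∑[ i ≤ m ] ∑[ j ≤ d ] B (toℕ i) (toℕ j) ≡ δ (G2 (suc m) 1 0 d) g
  secondPart = begin
    ∑[ i ≤ m ] ∑[ j ≤ d ] B (toℕ i) (toℕ j)
      ≡⟨ sum-cong-≗ {suc m} (λ i → ∑-vanishing-off (B (toℕ i)) z≤n (onlyFirstRow (toℕ i))) ⟩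
    ∑[ i ≤ m ] B (toℕ i) 0
      ≡⟨ ∑-vanishing-off (λ i → B i 0) ℕₚ.≤-refl onlyLastColumn ⟩
    B m 0
      ≡⟨ cong₂ (λ c l → ℕ→ℚ (c ℕ.* 1) ℚ.* 1ℚ ℚ.* δ (G2 (suc m) l 0 d) g)
           (nCn≡1 m) (ℕₚ.m+n∸n≡m 1 m) ⟩
    1ℚ ℚ.* δ (G2 (suc m) 1 0 d) g
      ≡⟨ ℚₚ.*-identityˡ _ ⟩
    δ (G2 (suc m) 1 0 d) g ∎
    where
    onlyFirstRow : ∀ i {e} → e ≤ d → e ≢ 0 → B i e ≡ 0ℚ
    onlyFirstRow i {zero}  _ e≢0 = contradiction refl e≢0
    onlyFirstRow i {suc e} _ _   = trans
      (cong (λ c → ℕ→ℚ c ℚ.* 1ℚ ℚ.* δ (gen d i (suc e)) g) (ℕₚ.*-zeroʳ (i C m)))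
      (ℚₚ.*-zeroˡ (δ (gen d i (suc e)) g))
    onlyLastColumn : ∀ {i} → i ≤ m → i ≢ m → B i 0 ≡ 0ℚ
    onlyLastColumn {i} i≤m i≢m = trans
      (cong (λ c → ℕ→ℚ (c ℕ.* 1) ℚ.* 1ℚ ℚ.* δ (gen d i 0) g) (k>n⇒nCk≡0 (ℕₚ.≤∧≢⇒< i≤m i≢m)))
      (ℚₚ.*-zeroˡ (δ (gen d i 0) g))

coeff-stuffleRel : ∀ k₁ k₂ d₁ d₂ g → coeff (stuffleRel k₁ k₂ d₁ d₂) g ≡
  δ (P2 k₁ k₂ d₁ d₂) g ℚ.- δ (G2 k₁ k₂ d₁ d₂) g ℚ.- δ (G2 k₂ k₁ d₂ d₁) g ℚ.- δ (G1 (k₁ + k₂) (d₁ + d₂)) g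
coeff-stuffleRel k₁ k₂ d₁ d₂ g = trans (coeff-expand (stuffleRel k₁ k₂ d₁ d₂) g)
  (solve 4 (λ p a b c → con 1ℚ :* p :+ (con (- 1ℚ) :* a :+ (con (- 1ℚ) :* b :+ (con (- 1ℚ) :* c :+ con 0ℚ)))
                        := p :- a :- b :- c)
    refl (δ (P2 k₁ k₂ d₁ d₂) g) (δ (G2 k₁ k₂ d₁ d₂) g) (δ (G2 k₂ k₁ d₂ d₁) g)
         (δ (G1 (k₁ + k₂) (d₁ + d₂)) g))
  where open +-*-Solver

coeff-shuffleRel : ∀ k₁ k₂ d₁ d₂ g → coeff (shuffleRel k₁ k₂ d₁ d₂) g ≡
  δ (P2 k₁ k₂ d₁ d₂) g ℚ.- (coeff (shuffleSum k₁ k₂ d₁ d₂) g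
    ℚ.+ factRatio d₁ d₂ ℚ.* ℕ→ℚ ((k₁ + k₂ ∸ 2) C (k₁ ∸ 1))
        ℚ.* δ (G1 (k₁ + k₂ ∸ 1) (suc (d₁ + d₂))) g)
coeff-shuffleRel k₁ k₂ d₁ d₂ g = begin
  coeff (shuffleRel k₁ k₂ d₁ d₂) g
    ≡⟨ coeff-∷ 1ℚ (P2 k₁ k₂ d₁ d₂) (neg tail) g ⟩
  1ℚ ℚ.* p ℚ.+ coeff (neg tail) g
    ≡⟨ cong (1ℚ ℚ.* p ℚ.+_) (trans (coeff-scale (- 1ℚ) tail g) (cong ((- 1ℚ) ℚ.*_)
         (trans (coeff-++ (shuffleSum k₁ k₂ d₁ d₂) ((r , G) ∷ []) g)
                (cong (s ℚ.+_) (coeff-singleton r G g))))) ⟩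
  1ℚ ℚ.* p ℚ.+ (- 1ℚ) ℚ.* (s ℚ.+ r ℚ.* δ G g)
    ≡⟨ solve 3 (λ p s t → con 1ℚ :* p :+ con (- 1ℚ) :* (s :+ t) := p :- (s :+ t)) refl p s (r ℚ.* δ G g) ⟩
  p ℚ.- (s ℚ.+ r ℚ.* δ G g) ∎
  where
  open ≡-Reasoning
  open +-*-Solver
  r : ℚ
  r = factRatio d₁ d₂ ℚ.* ℕ→ℚ ((k₁ + k₂ ∸ 2) C (k₁ ∸ 1))
  G : Gen
  G = G1 (k₁ + k₂ ∸ 1) (suc (d₁ + d₂))
  tail : Comb
  tail = shuffleSum k₁ k₂ d₁ d₂ ++ (r , G) ∷ []
  p s : ℚ
  p = δ (P2 k₁ k₂ d₁ d₂) g
  s = coeff (shuffleSum k₁ k₂ d₁ d₂) g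

coeff-prop41RHS : ∀ k d g →
  coeff (prop41RHS k d) g ≡ δ (G1 k d) g ℚ.- (+ 1 ℚ./ suc d) ℚ.* δ (G1 (k ∸ 1) (suc d)) g
coeff-prop41RHS k d g = trans (coeff-expand (prop41RHS k d) g)
  (solve 3 (λ c q c′ → con 1ℚ :* c :+ (:- q :* c′ :+ con 0ℚ) := c :- q :* c′)
    refl (δ (G1 k d) g) (+ 1 ℚ./ suc d) (δ (G1 (k ∸ 1) (suc d)) g))
  where open +-*-Solver

/-cross : ∀ a b c e .{{_ : NonZero b}} .{{_ : NonZero e}} →
  a ℕ.* e ≡ c ℕ.* b → + a ℚ./ b ≡ + c ℚ./ e
/-cross a (suc b) c (suc e) eq = ℚₚ.fromℚᵘ-cong {ℚᵘ.mkℚᵘ (+ a) b} {ℚᵘ.mkℚᵘ (+ c) e}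
  (ℚᵘ.*≡* (trans (sym (ℤₚ.pos-* a (suc e))) (trans (cong +_ eq) (ℤₚ.pos-* c (suc b)))))

factRatio-0 : ∀ d → factRatio d 0 ≡ + 1 ℚ./ suc d
factRatio-0 d = /-cross (d ! ℕ.* 1) (suc (d + 0) !) 1 (suc d) {{suc (d + 0) ℕₚ.!≢0}} cross
  where
  cross : d ! ℕ.* 1 ℕ.* suc d ≡ 1 ℕ.* suc (d + 0) !
  cross rewrite ℕₚ.+-identityʳ d =
    trans (cong (ℕ._* suc d) (ℕₚ.*-identityʳ (d !))) (trans (ℕₚ.*-comm (d !) (suc d)) (sym (ℕₚ.*-identityˡ _)))

coeff-stuffleRel-1-0 : ∀ m d g → coeff (stuffleRel 1 (suc m) d 0) g ≡
  δ (P2 1 (suc m) d 0) g ℚ.- δ (G2 1 (suc m) d 0) g ℚ.- δ (G2 (suc m) 1 0 d) g ℚ.- δ (G1 (2 + m) d) g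
coeff-stuffleRel-1-0 m d g = trans (coeff-stuffleRel 1 (suc m) d 0 g)
  (cong (λ D → δ (P2 1 (suc m) d 0) g ℚ.- δ (G2 1 (suc m) d 0) g ℚ.- δ (G2 (suc m) 1 0 d) g
                ℚ.- δ (G1 (2 + m) D) g)
    (ℕₚ.+-identityʳ d))

coeff-shuffleRel-1-0 : ∀ m d g → coeff (shuffleRel 1 (suc m) d 0) g ≡
  δ (P2 1 (suc m) d 0) g ℚ.- (coeff (prop41LHS (2 + m) d) g ℚ.+ δ (G2 1 (suc m) d 0) g ℚ.+ δ (G2 (suc m) 1 0 d) g
    ℚ.+ (+ 1 ℚ./ suc d) ℚ.* δ (G1 (suc m) (suc d)) g)
coeff-shuffleRel-1-0 m d g = trans (coeff-shuffleRel 1 (suc m) d 0 g)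
  (cong₂ (λ s t → δ (P2 1 (suc m) d 0) g ℚ.- (s ℚ.+ t))
    (trans (coeff-shuffleSum-1-0 m d g) (cong (ℚ._+ δ (G2 (suc m) 1 0 d) g) (sym (coeff-prop41LHS m d g))))
    (cong₂ (λ r D → r ℚ.* δ (G1 (suc m) (suc D)) g)
      (trans (ℚₚ.*-identityʳ (factRatio d 0)) (factRatio-0 d)) (ℕₚ.+-identityʳ d)))

proposition4p1 : (k d : ℕ) → 2 ≤ k → EqInE (k + d) (prop41LHS k d) (prop41RHS k d)
proposition4p1 k@(suc (suc m)) d (s≤s (s≤s z≤n)) = (1ℚ , stuffle) ∷ (- 1ℚ , shuffle) ∷ [] , coefficients
  where
  open ≡-Reasoning
  open +-*-Solver
  weight : 1 + suc m + d + 0 ≡ k + d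
  weight = ℕₚ.+-identityʳ (k + d)
  stuffle shuffle : RelIx (k + d)
  stuffle = relIx 1 (suc m) d 0 (s≤s z≤n) (s≤s z≤n) weight false
  shuffle = relIx 1 (suc m) d 0 (s≤s z≤n) (s≤s z≤n) weight true
  coefficients : ∀ g → coeff (prop41LHS k d ++ neg (prop41RHS k d)) g
                       ≡ coeff (relComb ((1ℚ , stuffle) ∷ (- 1ℚ , shuffle) ∷ [])) g
  coefficients g = begin
    coeff (prop41LHS k d ++ neg (prop41RHS k d)) g
      ≡⟨ trans (coeff-++-neg (prop41LHS k d) (prop41RHS k d) g)
           (cong (λ x → L ℚ.+ (- 1ℚ) ℚ.* x) (coeff-prop41RHS k d g)) ⟩
    L ℚ.+ (- 1ℚ) ℚ.* (c ℚ.- q ℚ.* c′)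
      ≡⟨ solve 7 (λ L p a b c c′ q → L :+ con (- 1ℚ) :* (c :- q :* c′)
           := con 1ℚ :* (p :- a :- b :- c)
              :+ (con (- 1ℚ) :* (p :- (L :+ a :+ b :+ q :* c′)) :+ con 0ℚ))
           refl L p a b c c′ q ⟩
    1ℚ ℚ.* (p ℚ.- a ℚ.- b ℚ.- c) ℚ.+ ((- 1ℚ) ℚ.* (p ℚ.- (L ℚ.+ a ℚ.+ b ℚ.+ q ℚ.* c′)) ℚ.+ 0ℚ)
      ≡⟨ sym (cong₂ (λ s t → 1ℚ ℚ.* s ℚ.+ ((- 1ℚ) ℚ.* t ℚ.+ 0ℚ))
               (coeff-stuffleRel-1-0 m d g) (coeff-shuffleRel-1-0 m d g)) ⟩
    1ℚ ℚ.* coeff (relOf stuffle) g ℚ.+ ((- 1ℚ) ℚ.* coeff (relOf shuffle) g ℚ.+ 0ℚ)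
      ≡⟨ sym (trans (coeff-relComb-∷ 1ℚ stuffle ((- 1ℚ , shuffle) ∷ []) g)
           (cong (1ℚ ℚ.* coeff (relOf stuffle) g ℚ.+_) (coeff-relComb-∷ (- 1ℚ) shuffle [] g))) ⟩
    coeff (relComb ((1ℚ , stuffle) ∷ (- 1ℚ , shuffle) ∷ [])) g ∎
    where
    L p a b c c′ q : ℚ
    L  = coeff (prop41LHS k d) g
    p  = δ (P2 1 (suc m) d 0) g
    a  = δ (G2 1 (suc m) d 0) g
    b  = δ (G2 (suc m) 1 0 d) g
    c  = δ (G1 k d) g
    c′ = δ (G1 (suc m) (suc d)) g
    q  = + 1 ℚ./ suc d
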